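{- Let $\mathrm{t}\neq\{\emptyset\}$ be a full binary tree, and let $u=u(\mathrm{t})=u_1\dots u_\ell$, $v_j$, $\mathrm{t}^{\mathrm{spn}}_j$, $\mathrm{t}^{\mathrm{free}}$, $\mathrm{t}^{\mathrm{fix}}$ be as in the context. Then the set $\{v\in\mathrm{t}:\mathcal{S}_v(\mathrm{t})=\mathcal{S}(\mathrm{t})\}$ is exactly the set of ancestors (prefixes) of $u(\mathrm{t})$; for every $1\le j\le\ell$, \[\mathcal{S}(\mathrm{t}^{\mathrm{spn}}_j)\le\frac{\mathcal{S}(\mathrm{t})-v_j}{2};\] moreover $\mathcal{S}(\mathrm{t}^{\mathrm{fix}})=\lceil\mathcal{S}(\mathrm{t})/2\rceil-1=\lfloor(\mathcal{S}(\mathrm{t})-1)/2\rfloor$ and $\lfloor\mathcal{S}(\mathrm{t})/2\rfloor\le\mathcal{S}(\mathrm{t}^{\mathrm{free}})\le\mathcal{S}(\mathrm{t})-1$.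
   Context: Let $\mathcal{U}=\{1,2\}^*$ be the set of finite words over $\{1,2\}$ (including the empty word $\emptyset$); $uv$ denotes concatenation, $uV=\{uv:v\in V\}$. A binary tree is a finite set $\mathrm{t}\subset\mathcal{U}$ containing $\emptyset$ and closed under taking prefixes; it is full if for all $u\in\mathrm{t}$, $u1\in\mathrm{t}\iff u2\in\mathrm{t}$. The ancestors of $u=u_1\dots u_\ell$ are the prefixes $u_1\dots u_k$, $0\le k\le\ell$. For $u\in\mathrm{t}$, $\theta_u\mathrm{t}=\{v:uv\in\mathrm{t}\}$. Let $\preceq_{\mathrm{lex}}$ be the lexicographic order on $\mathcal{U}$ and $u\wedge v$ the longest common prefix. An embedding of $\mathrm{t}$ in $\mathrm{t}'$ is an injective map $\varphi:\mathrm{t}\to\mathrm{t}'$, strictly increasing for $\preceq_{\mathrm{lex}}$, with $\varphi(u\wedge v)=\varphi(u)\wedge\varphi(v)$. Define $\tau_0=\{\emptyset\}$, $\tau_1=\{\emptyset,1,2\}$, and for $m\ge1$: $\tau_{2m}=\{\emptyset\}\cup 1\tau_m\cup 2\tau_{m-1}$, $\tau_{2m+1}=\{\emptyset\}\cup 1\tau_m\cup 2\tau_m$. The refined Horton--Strahler number is $\mathcal{S}(\mathrm{t})=\max\{r:\tau_r\text{ embeds in }\mathrm{t}\}$, and $\mathcal{S}_u(\mathrm{t})=\mathcal{S}(\theta_u\mathrm{t})$. For a full binary tree $\mathrm{t}\ne\{\emptyset\}$: $u(\mathrm{t})$ is the $\preceq_{\mathrm{lex}}$-maximal vertex $u\in\mathrm{t}$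 with $\mathcal{S}_u(\mathrm{t})=\mathcal{S}(\mathrm{t})$; $\ell=|u|$, $u=u_1\dots u_\ell$; for $1\le j\le\ell$, $v_j=3-u_j$ and $\mathrm{t}^{\mathrm{spn}}_j=\theta_{u_1\dots u_{j-1}v_j}\mathrm{t}$. When $u$ is internal (i.e. $u1,u2\in\mathrm{t}$), set $\mathrm{t}^{\mathrm{free}}=\theta_{u1}\mathrm{t}$ and $\mathrm{t}^{\mathrm{fix}}=\theta_{u2}\mathrm{t}$ if $\mathcal{S}(\mathrm{t})$ is even, and $\mathrm{t}^{\mathrm{free}}=\theta_{u2}\mathrm{t}$, $\mathrm{t}^{\mathrm{fix}}=\theta_{u1}\mathrm{t}$ if $\mathcal{S}(\mathrm{t})$ is odd. -}

module Defs where

open import Data.Nat.Base using (ℕ; zero; suc; _+_; _*_; _∸_; _≤_; ⌊_/2⌋; ⌈_/2⌉)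
open import Data.List.Base using (List; []; _∷_; _++_; [_]; map; mapMaybe)
open import Data.List.Membership.Propositional using (_∈_)
open import Data.Maybe.Base using (Maybe; just; nothing)
open import Data.Product.Base using (Σ; ∃; _×_; _,_)
open import Data.Sum.Base using (_⊎_)
open import Relation.Binary.PropositionalEquality using (_≡_)
open import Function.Bundles using (_⇔_)

data Dir : Set where
  one two : Dir

val : Dir → ℕ
val one = 1
val two = 2

flip : Dir → Dir
flip one = two
flip two = one

data _<D_ : Dir → Dir → Set where
  one<two : one <D two

Word : Set
Word = List Dir

data _≺_ : Word → Word → Set where
  halt : ∀ {y ys} → [] ≺ (y ∷ ys)
  this : ∀ {x y xs ys} → x <D y → (x ∷ xs) ≺ (y ∷ ys)
  next : ∀ {x xs ys} → xs ≺ ys → (x ∷ xs) ≺ (x ∷ ys)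

_⪯_ : Word → Word → Set
u ⪯ v = u ≡ v ⊎ u ≺ v

meet : Word → Word → Word
meet (one ∷ xs) (one ∷ ys) = one ∷ meet xs ys
meet (two ∷ xs) (two ∷ ys) = two ∷ meet xs ys
meet _ _ = []

IsPrefix : Word → Word → Set
IsPrefix u v = ∃ λ w → u ++ w ≡ v

-- Finite subsets of U, represented by lists (membership = _∈_)

Tree : Set
Tree = List Word

IsBinaryTree : Tree → Set
IsBinaryTree t = ([] ∈ t) × (∀ u v → u ++ v ∈ t → u ∈ t)

IsFull : Tree → Set
IsFull t = ∀ u → u ∈ t → ((u ++ [ one ] ∈ t) ⇔ (u ++ [ two ] ∈ t))

IsRoot : Tree → Set
IsRoot t = ∀ w → (w ∈ t) ⇔ (w ≡ [])

stripPrefix : Word → Word → Maybe Word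
stripPrefix [] w = just w
stripPrefix (one ∷ u) (one ∷ w) = stripPrefix u w
stripPrefix (two ∷ u) (two ∷ w) = stripPrefix u w
stripPrefix (_ ∷ _) _ = nothing

θ : Word → Tree → Tree
θ u t = mapMaybe (stripPrefix u) t

Embeds : Tree → Tree → Set
Embeds t t' = Σ (Word → Word) λ φ →
    (∀ w → w ∈ t → φ w ∈ t')
  × (∀ w w' → w ∈ t → w' ∈ t → φ w ≡ φ w' → w ≡ w')
  × (∀ w w' → w ∈ t → w' ∈ t → w ≺ w' → φ w ≺ φ w')
  × (∀ w w' → w ∈ t → w' ∈ t → φ (meet w w') ≡ meet (φ w) (φ w'))

node : Tree → Tree → Tree
node L R = [] ∷ (map (one ∷_) L ++ map (two ∷_) R)

-- fuel-based recursion; for r = 2m : left τ_m, right τ_{m-1};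
-- for r = 2m+1 : left τ_m, right τ_m.  (⌊r/2⌋ = m, ⌈r/2⌉ ∸ 1 = m-1 resp. m)
τF : ℕ → ℕ → Tree
τF zero _ = []
τF (suc f) zero = [ [] ]
τF (suc f) (suc zero) = [] ∷ [ one ] ∷ [ two ] ∷ []
τF (suc f) r@(suc (suc _)) = node (τF f ⌊ r /2⌋) (τF f (⌈ r /2⌉ ∸ 1))

τ : ℕ → Tree
τ r = τF (suc r) r

-- Refined Horton–Strahler number:  HS t s  means  S(t) = s,
-- i.e. s is the maximum of {r : τ_r embeds in t}.

HS : Tree → ℕ → Set
HS t s = Embeds (τ s) t × (∀ r → Embeds (τ r) t → r ≤ s)

IsU : Tree → ℕ → Word → Set
IsU t s u = (u ∈ t) × HS (θ u t) s × (∀ w → w ∈ t → HS (θ w t) s → w ⪯ u)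

-- parity convention for free/fix children
freeDir : ℕ → Dir
freeDir zero = one
freeDir (suc zero) = two
freeDir (suc (suc n)) = freeDir n

fixDir : ℕ → Dir
fixDir n = flip (freeDir n)

-- An embedding of τ_r = node τ_⌊r/2⌋ τ_(⌈r/2⌉-1) into a node either stays inside
-- one subtree or maps root to root, which gives the recursion
-- S = max(p, q, min(2p+1, 2q+2)) for subtree numbers p and q; in particular S
-- exists for every subtree. The vertices v with S_v(t) = S(t) = s are closed under
-- ancestors and pairwise comparable, since copies of τ_s below two siblings would
-- give τ_(2s+1); so they are the ancestors of the lex-maximal one, u. Along the spine
-- the child carrying τ_s makes its own term in the recursion exceed s, so the
-- minimum comes from the sibling. At u both children have S < s, hence
-- s = min(2p+1, 2q+2), and the parity of s decides which child is pinned at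
-- ⌈s/2⌉-1 and which is only bounded.
module Submission where

open import Defs
open import Data.Nat.Base
  using (ℕ; zero; suc; _+_; _*_; _∸_; _≤_; _<_; ⌊_/2⌋; ⌈_/2⌉; z≤n; s≤s; s≤s⁻¹; _⊔_; _⊓_)
open import Data.Nat.Properties
open import Data.List.Base using ([]; _∷_; _++_; [_]; map; mapMaybe; length; foldr; drop)
open import Data.List.Properties using (++-assoc; ++-identityʳ; ≡-dec; length-++-≤ʳ)
open import Data.List.Membership.Propositional using (_∈_)
open import Data.List.Membership.Propositional.Properties using (∈-++⁻; ∈-map⁻; ∈-++⁺ˡ; ∈-++⁺ʳ; ∈-map⁺)
open import Data.List.Relation.Unary.Any using (here; there)
open import Data.Maybe.Base using (Maybe; just; nothing)
open import Data.Product.Base using (Σ; ∃; _×_; _,_; proj₁; proj₂)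
open import Data.Sum.Base using (_⊎_; inj₁; inj₂) renaming (map to ⊎-map)
open import Data.Empty using (⊥-elim)
open import Function.Base using (_∘_)
open import Relation.Nullary using (¬_; Dec; yes; no)
open import Relation.Binary.PropositionalEquality
  using (_≡_; _≢_; refl; sym; trans; cong; cong₂; subst; subst₂)
open import Function.Bundles using (_⇔_; mk⇔; Equivalence)
open Equivalence using (to; from)

_≟D_ : (a b : Dir) → Dec (a ≡ b)
one ≟D one = yes refl
one ≟D two = no (λ ())
two ≟D one = no (λ ())
two ≟D two = yes refl

open import Data.List.Membership.DecPropositional (≡-dec _≟D_) using (_∈?_)

≺-irrefl : ∀ {w} → ¬ w ≺ w
≺-irrefl (this ())
≺-irrefl (next p) = ≺-irrefl p

≺-asym : ∀ {w w'} → w ≺ w' → ¬ w' ≺ w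
≺-asym (this one<two) (this ())
≺-asym (next p) (next q) = ≺-asym p q

≺-connex : ∀ w w' → w ≢ w' → w ≺ w' ⊎ w' ≺ w
≺-connex [] [] w≢w' = ⊥-elim (w≢w' refl)
≺-connex [] (_ ∷ _) _ = inj₁ halt
≺-connex (_ ∷ _) [] _ = inj₂ halt
≺-connex (one ∷ w) (one ∷ w') w≢w' = ⊎-map next next (≺-connex w w' (w≢w' ∘ cong (one ∷_)))
≺-connex (one ∷ w) (two ∷ w') _ = inj₁ (this one<two)
≺-connex (two ∷ w) (one ∷ w') _ = inj₂ (this one<two)
≺-connex (two ∷ w) (two ∷ w') w≢w' = ⊎-map next next (≺-connex w w' (w≢w' ∘ cong (two ∷_)))

≺-++-∷ : ∀ u d x → u ≺ (u ++ d ∷ x)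
≺-++-∷ [] d x = halt
≺-++-∷ (_ ∷ u) d x = next (≺-++-∷ u d x)

++⁺-≺ : ∀ x {a b} → a ≺ b → (x ++ a) ≺ (x ++ b)
++⁺-≺ [] p = p
++⁺-≺ (_ ∷ x) p = next (++⁺-≺ x p)

∷⁻-≺ : ∀ {d a b} → (d ∷ a) ≺ (d ∷ b) → a ≺ b
∷⁻-≺ (this ())
∷⁻-≺ (next p) = p

meet-++ : ∀ x a b → meet (x ++ a) (x ++ b) ≡ x ++ meet a b
meet-++ [] a b = refl
meet-++ (one ∷ x) a b = cong (one ∷_) (meet-++ x a b)
meet-++ (two ∷ x) a b = cong (two ∷_) (meet-++ x a b)

meet-∷ˡ-≡ : ∀ d x y → meet (d ∷ x) y ≡ d ∷ x → y ≡ d ∷ drop 1 y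
meet-∷ˡ-≡ one x (one ∷ y) _ = refl
meet-∷ˡ-≡ two x (two ∷ y) _ = refl
meet-∷ˡ-≡ one x [] ()
meet-∷ˡ-≡ one x (two ∷ y) ()
meet-∷ˡ-≡ two x [] ()
meet-∷ˡ-≡ two x (one ∷ y) ()

meet≡[]-heads : ∀ {a b} → [] ≺ a → a ≺ b → meet a b ≡ [] → (a ≡ one ∷ drop 1 a) × (b ≡ two ∷ drop 1 b)
meet≡[]-heads {one ∷ a} {two ∷ b} _ (this one<two) _ = refl , refl
meet≡[]-heads {one ∷ a} {one ∷ b} _ (next _) ()
meet≡[]-heads {two ∷ a} {two ∷ b} _ (next _) ()

++-∷-≢ : ∀ u (d : Dir) x → u ++ d ∷ x ≢ u
++-∷-≢ [] d x ()
++-∷-≢ (_ ∷ u) d x eq = ++-∷-≢ u d x (cong (drop 1) eq)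

data Position (v u : Word) : Set where
  ancestor : IsPrefix v u → Position v u
  descendant : ∀ d x → v ≡ u ++ d ∷ x → Position v u
  diverging : ∀ m d a b → v ≡ m ++ d ∷ a → u ≡ m ++ flip d ∷ b → Position v u

position-∷ : ∀ e {v u} → Position v u → Position (e ∷ v) (e ∷ u)
position-∷ e (ancestor (w , eq)) = ancestor (w , cong (e ∷_) eq)
position-∷ e (descendant d x eq) = descendant d x (cong (e ∷_) eq)
position-∷ e (diverging m d a b eq eq') = diverging (e ∷ m) d a b (cong (e ∷_) eq) (cong (e ∷_) eq')

position : ∀ v u → Position v u
position [] u = ancestor (u , refl)
position (d ∷ v) [] = descendant d v refl
position (one ∷ v) (one ∷ u) = position-∷ one (position v u)
position (two ∷ v) (two ∷ u) = position-∷ two (position v u)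
position (one ∷ v) (two ∷ u) = diverging [] one v u refl refl
position (two ∷ v) (one ∷ u) = diverging [] two v u refl refl

data NodeView (L R : Tree) : Word → Set where
  root : NodeView L R []
  left : ∀ {w} → w ∈ L → NodeView L R (one ∷ w)
  right : ∀ {w} → w ∈ R → NodeView L R (two ∷ w)

nodeView : ∀ {L R w} → w ∈ node L R → NodeView L R w
nodeView (here refl) = root
nodeView {L} (there p) with ∈-++⁻ (map (one ∷_) L) p
... | inj₁ q with ∈-map⁻ (one ∷_) q
...   | _ , w∈L , refl = left w∈L
nodeView (there p) | inj₂ q with ∈-map⁻ (two ∷_) q
...   | _ , w∈R , refl = right w∈R

root∈node : ∀ {L R} → [] ∈ node L R
root∈node = here refl

left∈node : ∀ {L R w} → w ∈ L → one ∷ w ∈ node L R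
left∈node w∈L = there (∈-++⁺ˡ (∈-map⁺ (one ∷_) w∈L))

right∈node : ∀ {L R w} → w ∈ R → two ∷ w ∈ node L R
right∈node {L} w∈R = there (∈-++⁺ʳ (map (one ∷_) L) (∈-map⁺ (two ∷_) w∈R))

infix 4 _↪_

-- Injectivity is not a field: it follows from strict monotonicity, ≺ being connex.
record _↪_ (T : Tree) (P : Word → Set) : Set where
  field
    φ : Word → Word
    into : ∀ {w} → w ∈ T → P (φ w)
    mono : ∀ {w w'} → w ∈ T → w' ∈ T → w ≺ w' → φ w ≺ φ w'
    meet-hom : ∀ {w w'} → w ∈ T → w' ∈ T → φ (meet w w') ≡ meet (φ w) (φ w')

  injective : ∀ {w w'} → w ∈ T → w' ∈ T → φ w ≡ φ w' → w ≡ w'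
  injective {w} {w'} w∈T w'∈T eq with ≡-dec _≟D_ w w'
  ... | yes w≡w' = w≡w'
  ... | no w≢w' with ≺-connex w w' w≢w'
  ...   | inj₁ w≺w' = ⊥-elim (≺-irrefl (subst (φ w ≺_) (sym eq) (mono w∈T w'∈T w≺w')))
  ...   | inj₂ w'≺w = ⊥-elim (≺-irrefl (subst (φ w' ≺_) eq (mono w'∈T w∈T w'≺w)))

open _↪_

↪⇒Embeds : ∀ {T t} → T ↪ (_∈ t) → Embeds T t
↪⇒Embeds e = φ e , (λ _ → into e) , (λ _ _ → injective e) , (λ _ _ → mono e) , (λ _ _ → meet-hom e)

Embeds⇒↪ : ∀ {T t} → Embeds T t → T ↪ (_∈ t)
Embeds⇒↪ (f , f-into , _ , f-mono , f-meet) = record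
  { φ = f ; into = f-into _ ; mono = f-mono _ _ ; meet-hom = f-meet _ _ }

↪-map : ∀ {T P Q} → (∀ {w} → P w → Q w) → T ↪ P → T ↪ Q
↪-map f e = record { φ = φ e ; into = f ∘ into e ; mono = mono e ; meet-hom = meet-hom e }

↪-id : ∀ {T} → T ↪ (_∈ T)
↪-id = record { φ = λ w → w ; into = λ w∈T → w∈T ; mono = λ _ _ p → p ; meet-hom = λ _ _ → refl }

↪-∘ : ∀ {T T' P} → T' ↪ (_∈ T) → T ↪ P → T' ↪ P
↪-∘ ι e = record
  { φ = φ e ∘ φ ι
  ; into = into e ∘ into ι
  ; mono = λ p p' r → mono e (into ι p) (into ι p') (mono ι p p' r)
  ; meet-hom = λ p p' → trans (cong (φ e) (meet-hom ι p p')) (meet-hom e (into ι p) (into ι p'))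
  }

↪-shift : ∀ {T P} x → T ↪ (λ w → P (x ++ w)) → T ↪ P
↪-shift x e = record
  { φ = λ w → x ++ φ e w
  ; into = into e
  ; mono = λ p p' r → ++⁺-≺ x (mono e p p' r)
  ; meet-hom = λ {w} {w'} p p' → trans (cong (x ++_) (meet-hom e p p')) (sym (meet-++ x (φ e w) (φ e w')))
  }

↪-unshift : ∀ {T P} d (e : T ↪ P) → (∀ {w} → w ∈ T → φ e w ≡ d ∷ drop 1 (φ e w)) →
  T ↪ (λ w → P (d ∷ w))
↪-unshift {P = P} d e head = record
  { φ = drop 1 ∘ φ e
  ; into = λ p → subst P (head p) (into e p)
  ; mono = λ p p' r → ∷⁻-≺ (subst₂ _≺_ (head p) (head p') (mono e p p' r))
  ; meet-hom = λ {w} {w'} p p' → cong (drop 1) (trans (meet-hom e p p')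
      (trans (cong₂ meet (head p) (head p')) (meet-++ [ d ] (drop 1 (φ e w)) (drop 1 (φ e w')))))
  }

↪-leaf : ∀ {P} → P [] → [ [] ] ↪ P
↪-leaf {P} p[] = record { φ = λ w → w ; into = into' ; mono = mono' ; meet-hom = λ _ _ → refl }
  where
  into' : ∀ {w} → w ∈ [ [] ] → P w
  into' (here refl) = p[]
  mono' : ∀ {w w'} → w ∈ [ [] ] → w' ∈ [ [] ] → w ≺ w' → w ≺ w'
  mono' (here refl) (here refl) ()

↪-node : ∀ {L R P} → P [] → L ↪ (λ w → P (one ∷ w)) → R ↪ (λ w → P (two ∷ w)) → node L R ↪ P
↪-node {L} {R} {P} p[] eL eR = record { φ = ψ ; into = into' ; mono = mono' ; meet-hom = meet' }
  where
  ψ : Word → Word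
  ψ [] = []
  ψ (one ∷ w) = one ∷ φ eL w
  ψ (two ∷ w) = two ∷ φ eR w
  into' : ∀ {w} → w ∈ node L R → P (ψ w)
  into' p with nodeView {L} {R} p
  ... | root = p[]
  ... | left q = into eL q
  ... | right q = into eR q
  mono' : ∀ {w w'} → w ∈ node L R → w' ∈ node L R → w ≺ w' → ψ w ≺ ψ w'
  mono' p p' r with nodeView {L} {R} p | nodeView {L} {R} p' | r
  ... | root | left _ | _ = halt
  ... | root | right _ | _ = halt
  ... | left _ | right _ | _ = this one<two
  ... | left q | left q' | r = next (mono eL q q' (∷⁻-≺ r))
  ... | right q | right q' | r = next (mono eR q q' (∷⁻-≺ r))
  ... | root | root | ()
  ... | right _ | left _ | this ()
  meet' : ∀ {w w'} → w ∈ node L R → w' ∈ node L R → ψ (meet w w') ≡ meet (ψ w) (ψ w')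
  meet' p p' with nodeView {L} {R} p | nodeView {L} {R} p'
  ... | root | _ = refl
  ... | left _ | root = refl
  ... | left q | left q' = cong (one ∷_) (meet-hom eL q q')
  ... | left _ | right _ = refl
  ... | right _ | root = refl
  ... | right _ | left _ = refl
  ... | right q | right q' = cong (two ∷_) (meet-hom eR q q')

↪-node-split : ∀ {L R P} → [] ∈ L → [] ∈ R → node L R ↪ P →
  (Σ Dir λ d → node L R ↪ (λ w → P (d ∷ w)))
  ⊎ (L ↪ (λ w → P (one ∷ w)) × R ↪ (λ w → P (two ∷ w)))
↪-node-split {L} {R} {P} []∈L []∈R e with φ e [] in φ[]≡
... | d ∷ x = inj₁ (d , ↪-unshift d e below-d)
  where
  below-d : ∀ {w} → w ∈ node L R → φ e w ≡ d ∷ drop 1 (φ e w)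
  below-d {w} p = meet-∷ˡ-≡ d x (φ e w)
    (subst (λ z → meet z (φ e w) ≡ z) φ[]≡ (sym (meet-hom e (root∈node {L} {R}) p)))
... | [] = inj₂ (↪-unshift one (↪-∘ ιL e) below-one , ↪-unshift two (↪-∘ ιR e) below-two)
  where
  ιL : L ↪ (_∈ node L R)
  ιL = ↪-shift [ one ] (↪-map left∈node ↪-id)
  ιR : R ↪ (_∈ node L R)
  ιR = ↪-shift [ two ] (↪-map right∈node ↪-id)
  1∈ : [ one ] ∈ node L R
  1∈ = left∈node []∈L
  2∈ : [ two ] ∈ node L R
  2∈ = right∈node []∈R
  heads : (φ e [ one ] ≡ one ∷ drop 1 (φ e [ one ])) × (φ e [ two ] ≡ two ∷ drop 1 (φ e [ two ]))
  heads = meet≡[]-heads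
    (subst (_≺ φ e [ one ]) φ[]≡ (mono e (root∈node {L} {R}) 1∈ halt))
    (mono e 1∈ 2∈ (this one<two))
    (trans (sym (meet-hom e 1∈ 2∈)) φ[]≡)
  below-one : ∀ {w} → w ∈ L → φ e (one ∷ w) ≡ one ∷ drop 1 (φ e (one ∷ w))
  below-one {w} p = meet-∷ˡ-≡ one _ (φ e (one ∷ w))
    (subst (λ z → meet z (φ e (one ∷ w)) ≡ z) (proj₁ heads) (sym (meet-hom e 1∈ (left∈node p))))
  below-two : ∀ {w} → w ∈ R → φ e (two ∷ w) ≡ two ∷ drop 1 (φ e (two ∷ w))
  below-two {w} p = meet-∷ˡ-≡ two _ (φ e (two ∷ w))
    (subst (λ z → meet z (φ e (two ∷ w)) ≡ z) (proj₂ heads) (sym (meet-hom e 2∈ (right∈node p))))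

τF-fuel : ∀ f g r → r < f → r < g → τF f r ≡ τF g r
τF-fuel (suc f) (suc g) zero _ _ = refl
τF-fuel (suc f) (suc g) (suc zero) _ _ = refl
τF-fuel (suc f) (suc g) (suc (suc n)) (s≤s r<f) (s≤s r<g) =
  cong₂ node (τF-fuel f g (suc ⌊ n /2⌋) (≤-trans left≤ r<f) (≤-trans left≤ r<g))
             (τF-fuel f g ⌊ suc n /2⌋ (≤-trans right≤ r<f) (≤-trans right≤ r<g))
  where
  left≤ = s≤s (s≤s (⌊n/2⌋≤n n))
  right≤ = s≤s (⌊n/2⌋≤n (suc n))

τ-suc : ∀ r → τ (suc r) ≡ node (τ ⌊ suc r /2⌋) (τ (⌈ suc r /2⌉ ∸ 1))
τ-suc zero = refl
τ-suc (suc n) =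
  cong₂ node (τF-fuel _ _ (suc ⌊ n /2⌋) (s≤s (s≤s (⌊n/2⌋≤n n))) ≤-refl)
             (τF-fuel _ _ ⌊ suc n /2⌋ (s≤s (⌊n/2⌋≤n (suc n))) ≤-refl)

τ-1+2* : ∀ s → τ (suc (s + s)) ≡ node (τ s) (τ s)
τ-1+2* s = trans (τ-suc (s + s))
  (cong₂ (λ a b → node (τ a) (τ b)) (sym (n≡⌈n+n/2⌉ s)) (sym (n≡⌊n+n/2⌋ s)))

[]∈τ : ∀ r → [] ∈ τ r
[]∈τ zero = here refl
[]∈τ (suc zero) = here refl
[]∈τ (suc (suc r)) = here refl

↪-τ-suc-split : ∀ {P} r → τ (suc r) ↪ P →
  (Σ Dir λ d → τ (suc r) ↪ (λ w → P (d ∷ w)))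
  ⊎ (τ ⌊ suc r /2⌋ ↪ (λ w → P (one ∷ w)) × τ (⌈ suc r /2⌉ ∸ 1) ↪ (λ w → P (two ∷ w)))
↪-τ-suc-split {P} r e with ↪-node-split ([]∈τ _) ([]∈τ _) (subst (_↪ P) (τ-suc r) e)
... | inj₁ (d , e') = inj₁ (d , subst (_↪ _) (sym (τ-suc r)) e')
... | inj₂ split = inj₂ split

¬τ-suc↪leaf : ∀ {P} r → (∀ {w} → P w → w ≡ []) → ¬ τ (suc r) ↪ P
¬τ-suc↪leaf {P} r only[] e = ≺-irrefl
  (subst₂ _≺_ (only[] (into e' 1∈)) (only[] (into e' 2∈)) (mono e' 1∈ 2∈ (this one<two)))
  where
  e' = subst (_↪ P) (τ-suc r) e
  1∈ = left∈node ([]∈τ ⌊ suc r /2⌋)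
  2∈ = right∈node {τ ⌊ suc r /2⌋} ([]∈τ (⌈ suc r /2⌉ ∸ 1))

-- Unlike HS, this also records that {r : τ_r ↪ P} is downward closed.
IsStrahler : (Word → Set) → ℕ → Set
IsStrahler P s = ∀ r → τ r ↪ P ⇔ r ≤ s

IsStrahler-resp : ∀ {P Q s} → (∀ {w} → P w ⇔ Q w) → IsStrahler P s → IsStrahler Q s
IsStrahler-resp P⇔Q S r = mk⇔ (to (S r) ∘ ↪-map (from P⇔Q)) (↪-map (to P⇔Q) ∘ from (S r))

IsStrahler⇒HS : ∀ {T s} → IsStrahler (_∈ T) s → HS T s
IsStrahler⇒HS S = ↪⇒Embeds (from (S _) ≤-refl) , λ r e → to (S r) (Embeds⇒↪ e)

HS-unique : ∀ {T s s'} → HS T s → IsStrahler (_∈ T) s' → s ≡ s'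
HS-unique (e , maximal) S = ≤-antisym (to (S _) (Embeds⇒↪ e)) (maximal _ (↪⇒Embeds (from (S _) ≤-refl)))

IsStrahler-leaf : ∀ {P} → P [] → (∀ {w} → P w → w ≡ []) → IsStrahler P 0
IsStrahler-leaf p[] only[] zero = mk⇔ (λ _ → z≤n) (λ _ → ↪-leaf p[])
IsStrahler-leaf p[] only[] (suc r) = mk⇔ (λ e → ⊥-elim (¬τ-suc↪leaf r only[] e)) (λ ())

⌊n/2⌋≤m⇔n≤1+m+m : ∀ n m → ⌊ n /2⌋ ≤ m ⇔ n ≤ suc (m + m)
⌊n/2⌋≤m⇔n≤1+m+m n m = mk⇔ (bound n m) λ n≤ → ≤-trans (⌊n/2⌋-mono n≤) (≤-reflexive (sym (n≡⌈n+n/2⌉ m)))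
  where
  bound : ∀ n m → ⌊ n /2⌋ ≤ m → n ≤ suc (m + m)
  bound zero m _ = z≤n
  bound (suc zero) m _ = s≤s z≤n
  bound (suc (suc n)) (suc m) (s≤s ≤m) rewrite +-suc m m = s≤s (s≤s (bound n m ≤m))

⌈n/2⌉∸1≤m⇔n≤2+m+m : ∀ n m → ⌈ n /2⌉ ∸ 1 ≤ m ⇔ n ≤ suc (suc (m + m))
⌈n/2⌉∸1≤m⇔n≤2+m+m zero m = mk⇔ (λ _ → z≤n) (λ _ → z≤n)
⌈n/2⌉∸1≤m⇔n≤2+m+m (suc zero) m = mk⇔ (λ _ → s≤s z≤n) (λ _ → z≤n)
⌈n/2⌉∸1≤m⇔n≤2+m+m (suc (suc n)) m =
  mk⇔ (s≤s ∘ to (⌊n/2⌋≤m⇔n≤1+m+m (suc n) m)) (from (⌊n/2⌋≤m⇔n≤1+m+m (suc n) m) ∘ s≤s⁻¹)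

≤⊔⇒≤⊎≤ : ∀ {r m n} → r ≤ m ⊔ n → r ≤ m ⊎ r ≤ n
≤⊔⇒≤⊎≤ {r} {m} {n} r≤ with ⊔-sel m n
... | inj₁ eq = inj₁ (subst (r ≤_) eq r≤)
... | inj₂ eq = inj₂ (subst (r ≤_) eq r≤)

-- τ_r embeds in a node with subtree numbers p and q either inside one subtree,
-- or root to root with τ_⌊r/2⌋ on the left and τ_(⌈r/2⌉-1) on the right, which
-- is possible iff r ≤ 2p+1 and r ≤ 2q+2.
strahlerNode : ℕ → ℕ → ℕ
strahlerNode p q = p ⊔ q ⊔ (suc (p + p) ⊓ suc (suc (q + q)))

IsStrahler-node : ∀ {P p q} → P [] →
  IsStrahler (λ w → P (one ∷ w)) p → IsStrahler (λ w → P (two ∷ w)) q → IsStrahler P (strahlerNode p q)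
IsStrahler-node {P} {p} {q} p[] Sp Sq r = mk⇔ (bound r) (build r)
  where
  bound : ∀ r → τ r ↪ P → r ≤ strahlerNode p q
  bound zero _ = z≤n
  bound (suc r) e with ↪-τ-suc-split r e
  ... | inj₁ (one , e') = ≤-trans (to (Sp _) e') (≤-trans (m≤m⊔n p q) (m≤m⊔n _ _))
  ... | inj₁ (two , e') = ≤-trans (to (Sq _) e') (≤-trans (m≤n⊔m p q) (m≤m⊔n _ _))
  ... | inj₂ (eL , eR) = ≤-trans
    (⊓-glb (to (⌊n/2⌋≤m⇔n≤1+m+m _ p) (to (Sp _) eL)) (to (⌈n/2⌉∸1≤m⇔n≤2+m+m _ q) (to (Sq _) eR)))
    (m≤n⊔m _ _)
  split : ∀ r → r ≤ suc (p + p) ⊓ suc (suc (q + q)) → τ r ↪ P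
  split zero _ = ↪-leaf p[]
  split (suc r) r≤ = subst (_↪ P) (sym (τ-suc r)) (↪-node p[]
    (from (Sp _) (from (⌊n/2⌋≤m⇔n≤1+m+m _ p) (≤-trans r≤ (m⊓n≤m _ _))))
    (from (Sq _) (from (⌈n/2⌉∸1≤m⇔n≤2+m+m _ q) (≤-trans r≤ (m⊓n≤n _ _)))))
  build : ∀ r → r ≤ strahlerNode p q → τ r ↪ P
  build r r≤ with ≤⊔⇒≤⊎≤ {r} {p ⊔ q} r≤
  ... | inj₂ r≤min = split r r≤min
  ... | inj₁ r≤p⊔q with ≤⊔⇒≤⊎≤ {r} {p} r≤p⊔q
  ...   | inj₁ r≤p = ↪-shift [ one ] (from (Sp r) r≤p)
  ...   | inj₂ r≤q = ↪-shift [ two ] (from (Sq r) r≤q)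

⊓≤⇒≤ˡ : ∀ {m n o} → m ⊓ n ≤ o → o < n → m ≤ o
⊓≤⇒≤ˡ {m} {n} h o<n with ⊓-sel m n
... | inj₁ eq = subst (_≤ _) eq h
... | inj₂ eq = ⊥-elim (<⇒≱ o<n (subst (_≤ _) eq h))

⊓≤⇒≤ʳ : ∀ {m n o} → m ⊓ n ≤ o → o < m → n ≤ o
⊓≤⇒≤ʳ {m} {n} h o<m with ⊓-sel m n
... | inj₁ eq = ⊥-elim (<⇒≱ o<m (subst (_≤ _) eq h))
... | inj₂ eq = subst (_≤ _) eq h

strahlerNode≤-left-large : ∀ {p q s} → strahlerNode p q ≤ s → s ≤ p → suc (suc (q + q)) ≤ s
strahlerNode≤-left-large {p} h s≤p = ⊓≤⇒≤ʳ (≤-trans (m≤n⊔m _ _) h) (s≤s (≤-trans s≤p (m≤m+n p p)))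

strahlerNode≤-right-large : ∀ {p q s} → strahlerNode p q ≤ s → s ≤ q → suc (p + p) ≤ s
strahlerNode≤-right-large {q = q} h s≤q =
  ⊓≤⇒≤ˡ (≤-trans (m≤n⊔m _ _) h) (s≤s (≤-trans s≤q (≤-trans (m≤m+n q q) (n≤1+n _))))

strahlerNode-cases : ∀ {s p q} → s ≡ strahlerNode p q → p < s → q < s →
  (s ≡ suc (suc (q + q)) × q < p) ⊎ (s ≡ suc (p + p) × p ≤ q)
strahlerNode-cases {s} {p} {q} s≡ p<s q<s with ⊔-sel (p ⊔ q) (suc (p + p) ⊓ suc (suc (q + q))) | p ≤? q
... | inj₁ eq | _ = ⊥-elim (<-irrefl (sym (trans s≡ eq)) (⊔-lub p<s q<s))
... | inj₂ eq | yes p≤q = inj₂ (trans (trans s≡ eq) (m≤n⇒m⊓n≡m (s≤s (≤-trans (+-mono-≤ p≤q p≤q) (n≤1+n _)))) , p≤q)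
... | inj₂ eq | no p≰q = inj₁ (trans (trans s≡ eq) (m≥n⇒m⊓n≡n 2+q+q≤1+p+p) , q<p)
  where
  q<p = ≰⇒> p≰q
  2+q+q≤1+p+p : suc (suc (q + q)) ≤ suc (p + p)
  2+q+q≤1+p+p = s≤s (≤-trans (s≤s (+-monoʳ-≤ q (n≤1+n q))) (+-mono-≤ q<p q<p))

2*n+m≡m+[n+n] : ∀ n m → 2 * n + m ≡ m + (n + n)
2*n+m≡m+[n+n] n m = trans (+-comm (2 * n) m) (cong (λ z → m + (n + z)) (+-identityʳ n))

freeDir-even : ∀ q → freeDir (q + q) ≡ one
freeDir-even zero = refl
freeDir-even (suc q) rewrite +-suc q q = freeDir-even q

freeDir-odd : ∀ p → freeDir (suc (p + p)) ≡ two
freeDir-odd zero = refl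
freeDir-odd (suc p) rewrite +-suc p p = freeDir-odd p

⌈n/2⌉∸1≡⌊n∸1/2⌋ : ∀ n → ⌈ n /2⌉ ∸ 1 ≡ ⌊ n ∸ 1 /2⌋
⌈n/2⌉∸1≡⌊n∸1/2⌋ zero = refl
⌈n/2⌉∸1≡⌊n∸1/2⌋ (suc zero) = refl
⌈n/2⌉∸1≡⌊n∸1/2⌋ (suc (suc n)) = refl

fixDir-freeDir : ∀ (G : Dir → ℕ → Set) {s p q} → G one p → G two q →
  (s ≡ suc (suc (q + q)) × q < p) ⊎ (s ≡ suc (p + p) × p ≤ q) → p < s → q < s →
  G (fixDir s) (⌈ s /2⌉ ∸ 1) × ∃ λ k → G (freeDir s) k × ⌊ s /2⌋ ≤ k × k ≤ s ∸ 1
fixDir-freeDir G {p = p} {q} Gp Gq (inj₁ (refl , q<p)) p<s _ =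
  subst₂ G (cong flip (sym (freeDir-even q))) (n≡⌈n+n/2⌉ q) Gq ,
  _ , subst (λ d → G d _) (sym (freeDir-even q)) Gp , subst (_≤ p) (cong suc (n≡⌊n+n/2⌋ q)) q<p , s≤s⁻¹ p<s
fixDir-freeDir G {p = p} {q} Gp Gq (inj₂ (refl , p≤q)) _ q<s =
  subst₂ G (cong flip (sym (freeDir-odd p))) (n≡⌊n+n/2⌋ p) Gp ,
  _ , subst (λ d → G d _) (sym (freeDir-odd p)) Gq , subst (_≤ q) (n≡⌈n+n/2⌉ p) p≤q , s≤s⁻¹ q<s

∈-mapMaybe⁺ : ∀ {A B : Set} (f : A → Maybe B) {x y} xs → f x ≡ just y → x ∈ xs → y ∈ mapMaybe f xs
∈-mapMaybe⁺ f (z ∷ xs) fx≡ (here refl) rewrite fx≡ = here refl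
∈-mapMaybe⁺ f (z ∷ xs) fx≡ (there p) with f z
... | just _ = there (∈-mapMaybe⁺ f xs fx≡ p)
... | nothing = ∈-mapMaybe⁺ f xs fx≡ p

∈-mapMaybe⁻ : ∀ {A B : Set} (f : A → Maybe B) {y} xs → y ∈ mapMaybe f xs → ∃ λ x → x ∈ xs × f x ≡ just y
∈-mapMaybe⁻ f (z ∷ xs) p with f z in fz≡
∈-mapMaybe⁻ f (z ∷ xs) (here refl) | just _ = z , here refl , fz≡
∈-mapMaybe⁻ f (z ∷ xs) (there p) | just _ with ∈-mapMaybe⁻ f xs p
... | x , x∈ , fx≡ = x , there x∈ , fx≡
∈-mapMaybe⁻ f (z ∷ xs) p | nothing with ∈-mapMaybe⁻ f xs p
... | x , x∈ , fx≡ = x , there x∈ , fx≡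

stripPrefix-++ : ∀ v x → stripPrefix v (v ++ x) ≡ just x
stripPrefix-++ [] x = refl
stripPrefix-++ (one ∷ v) x = stripPrefix-++ v x
stripPrefix-++ (two ∷ v) x = stripPrefix-++ v x

stripPrefix≡just⇒++ : ∀ v {w x} → stripPrefix v w ≡ just x → w ≡ v ++ x
stripPrefix≡just⇒++ [] refl = refl
stripPrefix≡just⇒++ (one ∷ v) {one ∷ w} eq = cong (one ∷_) (stripPrefix≡just⇒++ v eq)
stripPrefix≡just⇒++ (two ∷ v) {two ∷ w} eq = cong (two ∷_) (stripPrefix≡just⇒++ v eq)
stripPrefix≡just⇒++ (one ∷ v) {[]} ()
stripPrefix≡just⇒++ (one ∷ v) {two ∷ w} ()
stripPrefix≡just⇒++ (two ∷ v) {[]} ()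
stripPrefix≡just⇒++ (two ∷ v) {one ∷ w} ()

∈-θ : ∀ {t v x} → x ∈ θ v t ⇔ v ++ x ∈ t
∈-θ {t} {v} {x} = mk⇔ to' (∈-mapMaybe⁺ (stripPrefix v) t (stripPrefix-++ v x))
  where
  to' : x ∈ θ v t → v ++ x ∈ t
  to' p with ∈-mapMaybe⁻ (stripPrefix v) t p
  ... | w , w∈t , eq = subst (_∈ t) (stripPrefix≡just⇒++ v eq) w∈t

height : Tree → ℕ
height = foldr (λ w h → length w ⊔ h) 0

length≤height : ∀ {t w} → w ∈ t → length w ≤ height t
length≤height (here refl) = m≤m⊔n _ _
length≤height (there p) = ≤-trans (length≤height p) (m≤n⊔m _ _)

module Subtrees (t : Tree) (bt : IsBinaryTree t) (full : IsFull t) where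

  Below : Word → Word → Set
  Below v w = v ++ w ∈ t

  prefix-closed : ∀ v w → v ++ w ∈ t → v ∈ t
  prefix-closed = proj₂ bt

  Below-[] : ∀ {v} → v ∈ t → Below v []
  Below-[] {v} = subst (_∈ t) (sym (++-identityʳ v))

  Below-++ : ∀ v w {x} → Below (v ++ w) x ⇔ Below v (w ++ x)
  Below-++ v w {x} = mk⇔ (subst (_∈ t) (++-assoc v w x)) (subst (_∈ t) (sym (++-assoc v w x)))

  Below-leaf : ∀ v → ¬ Below v [ one ] → ∀ {w} → Below v w → w ≡ []
  Below-leaf v no-child {[]} _ = refl
  Below-leaf v no-child {one ∷ w} p = ⊥-elim (no-child (prefix-closed _ w (from (Below-++ v [ one ]) p)))
  Below-leaf v no-child {two ∷ w} p = ⊥-elim (no-child (from (full v (prefix-closed v _ p))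
    (prefix-closed _ w (from (Below-++ v [ two ]) p))))

  ↪-ancestor : ∀ {T} v w → T ↪ Below (v ++ w) → T ↪ Below v
  ↪-ancestor v w e = ↪-shift w (↪-map (to (Below-++ v w)) e)

  ↪-child : ∀ {T} v d a → T ↪ Below (v ++ d ∷ a) → T ↪ (λ x → Below v (d ∷ x))
  ↪-child v d a e = ↪-shift a (↪-map (to (Below-++ v (d ∷ a))) e)

  IsStrahler-child : ∀ {s} v d → IsStrahler (Below (v ++ [ d ])) s → IsStrahler (λ x → Below v (d ∷ x)) s
  IsStrahler-child v d = IsStrahler-resp (Below-++ v [ d ])

  IsStrahler⇒HS-θ : ∀ {v s} → IsStrahler (Below v) s → HS (θ v t) s
  IsStrahler⇒HS-θ = IsStrahler⇒HS ∘ IsStrahler-resp (mk⇔ (from ∈-θ) (to ∈-θ))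

  HS-θ-unique : ∀ {v s s'} → HS (θ v t) s → IsStrahler (Below v) s' → s ≡ s'
  HS-θ-unique h = HS-unique h ∘ IsStrahler-resp (mk⇔ (from ∈-θ) (to ∈-θ))

  HS-θ⇒↪ : ∀ {v s} → HS (θ v t) s → τ s ↪ Below v
  HS-θ⇒↪ = ↪-map (to ∈-θ) ∘ Embeds⇒↪ ∘ proj₁

  strahler-bounded : ∀ n v → v ∈ t → (∀ {w} → Below v w → length w ≤ n) → Σ ℕ (IsStrahler (Below v))
  strahler-bounded n v v∈t bounded with (v ++ [ one ]) ∈? t
  ... | no leaf = 0 , IsStrahler-leaf (Below-[] v∈t) (Below-leaf v leaf)
  strahler-bounded zero v v∈t bounded | yes v1∈t with () ← bounded v1∈t
  strahler-bounded (suc n) v v∈t bounded | yes v1∈t =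
    strahlerNode (proj₁ S₁) (proj₁ S₂) ,
    IsStrahler-node (Below-[] v∈t) (IsStrahler-child v one (proj₂ S₁)) (IsStrahler-child v two (proj₂ S₂))
    where
    S : ∀ d → v ++ [ d ] ∈ t → Σ ℕ (IsStrahler (Below (v ++ [ d ])))
    S d vd∈t = strahler-bounded n (v ++ [ d ]) vd∈t (s≤s⁻¹ ∘ bounded ∘ to (Below-++ v [ d ]))
    S₁ = S one v1∈t
    S₂ = S two (to (full v v∈t) v1∈t)

  strahler : ∀ v → v ∈ t → Σ ℕ (IsStrahler (Below v))
  strahler v v∈t = strahler-bounded (height t) v v∈t λ {w} p → ≤-trans (length-++-≤ʳ w {v}) (length≤height p)

module Spine (t : Tree) (bt : IsBinaryTree t) (full : IsFull t) (not-root : ¬ IsRoot t)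
             (s : ℕ) (u : Word) (hs : HS t s) (is-u : IsU t s u) where

  open Subtrees t bt full

  u∈t : u ∈ t
  u∈t = proj₁ is-u

  hs-u : HS (θ u t) s
  hs-u = proj₁ (proj₂ is-u)

  ↪⇒≤s : ∀ {r} v → τ r ↪ Below v → r ≤ s
  ↪⇒≤s v e = proj₂ hs _ (↪⇒Embeds (↪-shift v e))

  τs↪⇒HS : ∀ v → τ s ↪ Below v → HS (θ v t) s
  τs↪⇒HS v e = ↪⇒Embeds (↪-map (from ∈-θ) e) , λ r e' → ↪⇒≤s v (↪-map (to ∈-θ) (Embeds⇒↪ e'))

  ancestor⇒HS : ∀ v → IsPrefix v u → HS (θ v t) s
  ancestor⇒HS v (w , vw≡u) = τs↪⇒HS v (↪-ancestor v w (subst (λ z → τ s ↪ Below z) (sym vw≡u) (HS-θ⇒↪ hs-u)))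

  -- Two copies of τ_s below distinct children of m give τ_(2s+1) = node τ_s τ_s below m.
  ¬diverging-copies : ∀ m d a b → m ∈ t → τ s ↪ Below (m ++ d ∷ a) → ¬ τ s ↪ Below (m ++ flip d ∷ b)
  ¬diverging-copies m d a b m∈t e e' = <⇒≱ (s≤s (m≤m+n s s))
    (↪⇒≤s m (subst (_↪ Below m) (sym (τ-1+2* s)) (copies d (↪-child m d a e) (↪-child m (flip d) b e'))))
    where
    copies : ∀ d → τ s ↪ (λ x → Below m (d ∷ x)) → τ s ↪ (λ x → Below m (flip d ∷ x)) → node (τ s) (τ s) ↪ Below m
    copies one x y = ↪-node (Below-[] m∈t) x y
    copies two x y = ↪-node (Below-[] m∈t) y x

  HS⇒ancestor : ∀ v → v ∈ t → HS (θ v t) s → IsPrefix v u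
  HS⇒ancestor v v∈t hv with position v u
  ... | ancestor v≤u = v≤u
  ... | descendant d x refl with proj₂ (proj₂ is-u) v v∈t hv
  ...   | inj₁ v≡u = ⊥-elim (++-∷-≢ u d x v≡u)
  ...   | inj₂ v≺u = ⊥-elim (≺-asym v≺u (≺-++-∷ u d x))
  HS⇒ancestor v v∈t hv | diverging m d a b refl u≡ = ⊥-elim (¬diverging-copies m d a b
    (prefix-closed m _ v∈t) (HS-θ⇒↪ hv) (subst (λ z → τ s ↪ Below z) u≡ (HS-θ⇒↪ hs-u)))

  -- The spine child w d carries τ_s, which forces the minimum in strahlerNode at w
  -- to be the one coming from the sibling w (flip d).
  spine-sibling : ∀ w d rest → u ≡ w ++ d ∷ rest →
    ∃ λ k → HS (θ (w ++ [ flip d ]) t) k × 2 * k + val (flip d) ≤ s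
  spine-sibling w d rest u≡ = sibling d wd∈t (↪-child w d rest (subst (λ z → τ s ↪ Below z) u≡ (HS-θ⇒↪ hs-u)))
    where
    wd∈t : w ++ [ d ] ∈ t
    wd∈t = prefix-closed (w ++ [ d ]) rest (from (Below-++ w [ d ]) (subst (_∈ t) u≡ u∈t))
    w∈t = prefix-closed w [ d ] wd∈t
    node≤s : ∀ {p q} → IsStrahler (Below (w ++ [ one ])) p → IsStrahler (Below (w ++ [ two ])) q →
      strahlerNode p q ≤ s
    node≤s Sp Sq = ↪⇒≤s w (from (IsStrahler-node (Below-[] w∈t)
      (IsStrahler-child w one Sp) (IsStrahler-child w two Sq) _) ≤-refl)
    sibling : ∀ d → w ++ [ d ] ∈ t → τ s ↪ (λ x → Below w (d ∷ x)) →
      ∃ λ k → HS (θ (w ++ [ flip d ]) t) k × 2 * k + val (flip d) ≤ s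
    sibling one w1∈t e with strahler _ w1∈t | strahler _ (to (full w w∈t) w1∈t)
    ... | p , Sp | k , Sk = k , IsStrahler⇒HS-θ Sk , subst (_≤ s) (sym (2*n+m≡m+[n+n] k 2))
      (strahlerNode≤-left-large (node≤s Sp Sk) (to (IsStrahler-child w one Sp s) e))
    sibling two w2∈t e with strahler _ (from (full w w∈t) w2∈t) | strahler _ w2∈t
    ... | k , Sk | q , Sq = k , IsStrahler⇒HS-θ Sk , subst (_≤ s) (sym (2*n+m≡m+[n+n] k 1))
      (strahlerNode≤-right-large (node≤s Sk Sq) (to (IsStrahler-child w two Sq s) e))

  -- If u were a leaf, S(t) = 0 would contradict τ_1 ↪ t, as t ≠ {∅} is full.
  u1∈t : u ++ [ one ] ∈ t
  u1∈t with (u ++ [ one ]) ∈? t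
  ... | yes u1∈t = u1∈t
  ... | no u-leaf with [ one ] ∈? t
  ...   | no root-leaf = ⊥-elim (not-root λ w → mk⇔ (Below-leaf [] root-leaf) λ { refl → proj₁ bt })
  ...   | yes 1∈t = ⊥-elim (<⇒≱ (s≤s z≤n) (subst (1 ≤_) s≡0 (proj₂ hs 1 (↪⇒Embeds τ1↪t))))
    where
    s≡0 = HS-θ-unique hs-u (IsStrahler-leaf (Below-[] u∈t) (Below-leaf u u-leaf))
    τ1↪t : τ 1 ↪ (_∈ t)
    τ1↪t = ↪-node (proj₁ bt) (↪-leaf {λ w → one ∷ w ∈ t} 1∈t) (↪-leaf {λ w → two ∷ w ∈ t} (to (full [] (proj₁ bt)) 1∈t))

  u2∈t : u ++ [ two ] ∈ t
  u2∈t = to (full u u∈t) u1∈t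

  child-strahler-< : ∀ d {k} → u ++ [ d ] ∈ t → IsStrahler (Below (u ++ [ d ])) k → k < s
  child-strahler-< d {k} ud∈t Sk = ≤∧≢⇒< (↪⇒≤s _ (from (Sk k) ≤-refl)) k≢s
    where
    k≢s : k ≢ s
    k≢s refl with HS⇒ancestor (u ++ [ d ]) ud∈t (IsStrahler⇒HS-θ Sk)
    ... | c , eq = ++-∷-≢ u d c (trans (sym (++-assoc u [ d ] c)) eq)

  fix-and-free : HS (θ (u ++ [ fixDir s ]) t) (⌈ s /2⌉ ∸ 1)
    × ∃ λ k → HS (θ (u ++ [ freeDir s ]) t) k × ⌊ s /2⌋ ≤ k × k ≤ s ∸ 1
  fix-and-free with strahler _ u1∈t | strahler _ u2∈t
  ... | p , Sp | q , Sq = fixDir-freeDir (λ d k → HS (θ (u ++ [ d ]) t) k)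
    (IsStrahler⇒HS-θ Sp) (IsStrahler⇒HS-θ Sq) (strahlerNode-cases s≡ p<s q<s) p<s q<s
    where
    s≡ = HS-θ-unique hs-u (IsStrahler-node (Below-[] u∈t) (IsStrahler-child u one Sp) (IsStrahler-child u two Sq))
    p<s = child-strahler-< one u1∈t Sp
    q<s = child-strahler-< two u2∈t Sq

corollary2p2 : (t : Tree) → IsBinaryTree t → IsFull t → ¬ IsRoot t →
    (s : ℕ) (u : Word) → HS t s → IsU t s u →
      ((v : Word) → v ∈ t → (HS (θ v t) s ⇔ IsPrefix v u))
    × ((w : Word) (d : Dir) (rest : Word) → u ≡ w ++ (d ∷ rest) →
        ∃ λ k → HS (θ (w ++ [ flip d ]) t) k × 2 * k + val (flip d) ≤ s)
    × (u ++ [ one ] ∈ t) × (u ++ [ two ] ∈ t)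
    × HS (θ (u ++ [ fixDir s ]) t) (⌈ s /2⌉ ∸ 1)
    × (⌈ s /2⌉ ∸ 1 ≡ ⌊ s ∸ 1 /2⌋)
    × (∃ λ k → HS (θ (u ++ [ freeDir s ]) t) k × ⌊ s /2⌋ ≤ k × k ≤ s ∸ 1)
corollary2p2 t bt full not-root s u hs is-u =
  (λ v v∈t → mk⇔ (HS⇒ancestor v v∈t) (ancestor⇒HS v)) ,
  spine-sibling , u1∈t , u2∈t ,
  proj₁ fix-and-free , ⌈n/2⌉∸1≡⌊n∸1/2⌋ s , proj₂ fix-and-free
  where open Spine t bt full not-root s u hs is-u
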